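{- Let $t\ge3$, let $G$ be a graph, let $N\subseteq V(G)$ be a set of non-$K_t$-vertices of $G$, and let $\mathcal T$ be a root of $G-N$. Then for any partition $\mathcal P$ of $V(\mathcal T)$, the family $\{C(Z): Z\in\mathcal P\}\cup\{N\}$ is an additive partition of $G$, i.e. $\mathrm{opt}(G)=\mathrm{opt}(G[N])+\sum_{Z\in\mathcal P}\mathrm{opt}(G[C(Z)])$.
   Context: A $t$-clique is a set of $t$ pairwise adjacent vertices; $\mathrm{opt}(G)$ is the minimum size of a set intersecting all $t$-cliques of $G$. $N$ is a set of non-$K_t$-vertices if $K\cap N=\emptyset$ for every $t$-clique $K$ of $G$. For a connected graph $G'$, a root is a nonempty $T\subseteq V(G')$ with $G'[T]$ connected and $K_t$-free such that each connected component $C$ of $G'-T$ has $|N(C)\cap T|=1$; for an arbitrary graph $G'$, a root is a family $\mathcal T=\{T_C\}$ with one root $T_C$ of $G'[C]$ per connected component $C$, and $V(\mathcal T)=\bigcup_C T_C$. For $v\in V(\mathcal T)$ (here $G'=G-N$), the pending component $C(v)$ is the vertex set of the connected component containing $v$ of the graph obtained from $G-N$ by deleting all edges with both endpoints in the same $T_C$; for $Z\subseteq V(\mathcal T)$, $C(Z)=\bigcup_{v\in Z}C(v)$. -}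

module Defs where

open import Data.Nat using (ℕ; _≤_)
open import Data.Fin using (Fin)
open import Data.Fin.Subset using (Subset; ∣_∣) renaming (_∈_ to _∈ₛ_; _∉_ to _∉ₛ_)
open import Data.Product using (Σ; ∃; _×_; _,_)
open import Data.List using (tabulate)
open import Data.Nat.ListAction using (sum)
open import Relation.Nullary using (¬_)
open import Relation.Binary.PropositionalEquality using (_≡_; _≢_)

record Graph (n : ℕ) : Set₁ where
  field
    E      : Fin n → Fin n → Set
    sym    : ∀ {u v} → E u v → E v u
    irrefl : ∀ {u} → ¬ E u u
open Graph public

VSet : ℕ → Set₁
VSet n = Fin n → Set

module _ {n : ℕ} where

  data Path (R : Fin n → Fin n → Set) (X : VSet n) : Fin n → Fin n → Set where
    stop : ∀ {u} → X u → Path R X u u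
    step : ∀ {u w v} → X u → R u w → Path R X w v → Path R X u v

  ConnectedIn : (R : Fin n → Fin n → Set) → VSet n → Set
  ConnectedIn R X = (∃ λ v → X v) × (∀ u v → X u → X v → Path R X u v)

  IsComponent : (R : Fin n → Fin n → Set) → (X D : VSet n) → Set
  IsComponent R X D =
    (∀ v → D v → X v) × ConnectedIn R D × (∀ u v → D u → Path R X u v → D v)

  IsClique : Graph n → ℕ → Subset n → Set
  IsClique G t K = ∣ K ∣ ≡ t × (∀ u v → u ∈ₛ K → v ∈ₛ K → u ≢ v → E G u v)

  IsCliqueIn : Graph n → ℕ → VSet n → Subset n → Set
  IsCliqueIn G t X K = (∀ v → v ∈ₛ K → X v) × IsClique G t K

  IsTransversal : Graph n → ℕ → VSet n → Subset n → Set
  IsTransversal G t X S =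
    (∀ v → v ∈ₛ S → X v) ×
    (∀ K → IsCliqueIn G t X K → ∃ λ v → v ∈ₛ S × v ∈ₛ K)

  Opt : Graph n → ℕ → VSet n → ℕ → Set
  Opt G t X k =
    (∃ λ S → IsTransversal G t X S × ∣ S ∣ ≡ k) ×
    (∀ S → IsTransversal G t X S → k ≤ ∣ S ∣)

  NonKtVertices : Graph n → ℕ → Subset n → Set
  NonKtVertices G t N = ∀ K → IsClique G t K → ∀ v → v ∈ₛ K → v ∉ₛ N

  Minus : Subset n → VSet n
  Minus N v = v ∉ₛ N

  IsRootOfConnected : Graph n → ℕ → VSet n → VSet n → Set₁
  IsRootOfConnected G t C T =
    (∀ v → T v → C v) ×
    ConnectedIn (E G) T ×
    (∀ K → ¬ IsCliqueIn G t T K) ×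
    (∀ D → IsComponent (E G) (λ v → C v × ¬ T v) D →
      ∃ λ v → (T v × ∃ λ d → D d × E G d v) ×
        (∀ w → T w → (∃ λ d → D d × E G d w) → w ≡ v))

  -- A root family {T_C} of G - N, represented by its union V(𝒯) (the T_C are the
  -- traces T ∩ C on the components C of G - N).
  IsRoot : Graph n → ℕ → Subset n → Subset n → Set₁
  IsRoot G t N T =
    (∀ v → v ∈ₛ T → v ∉ₛ N) ×
    (∀ C → IsComponent (E G) (Minus N) C →
      IsRootOfConnected G t C (λ v → C v × v ∈ₛ T))

  -- Edges of G - N with both endpoints in the same T_C deleted.  (Edges of G - N
  -- joining two vertices of V(𝒯) always lie inside one component, hence one T_C.)
  PendingEdge : Graph n → Subset n → Subset n → Fin n → Fin n → Set
  PendingEdge G N T u w = E G u w × ¬ (u ∈ₛ T × w ∈ₛ T)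

  Pending : Graph n → Subset n → Subset n → Fin n → VSet n
  Pending G N T v w = Path (PendingEdge G N T) (Minus N) v w

  PendingSet : Graph n → Subset n → Subset n → Subset n → VSet n
  PendingSet G N T Z w = ∃ λ v → v ∈ₛ Z × Pending G N T v w

  IsPartitionOf : ∀ {m} → (Fin m → Subset n) → Subset n → Set
  IsPartitionOf {m} P T =
    (∀ i → ∃ λ v → v ∈ₛ P i) ×
    (∀ i j v → v ∈ₛ P i → v ∈ₛ P j → i ≡ j) ×
    (∀ v → v ∈ₛ T → ∃ λ i → v ∈ₛ P i) ×
    (∀ i v → v ∈ₛ P i → v ∈ₛ T)

sumFin : ∀ {m} → (Fin m → ℕ) → ℕ
sumFin {m} f = sum (tabulate f)

-- Each t-clique K of G avoids N and cannot lie inside the K_t-free root, so some vertex of K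
-- lies in a component D of G − N − V(𝒯); D has a unique neighbour r in V(𝒯), and all of K
-- lies in the pending component C(r).  Pending components of distinct root vertices are
-- disjoint, because along a pending path the root vertex "owning" the current vertex never
-- changes.  Hence the sets C(Z), Z ∈ 𝒫, are disjoint and every t-clique lies inside one of
-- them, which makes opt additive over them, while G[N] has no t-clique at all.
module Submission where

open import Defs renaming (sym to E-sym)
open import Data.Nat using (ℕ; zero; suc; _≤_; _<_; _+_; z≤n; s≤s)
open import Data.Nat.Properties
  using (≤-refl; ≤-trans; ≤-antisym; ≤-reflexive; _≤?_; +-suc; +-mono-≤; +-identityʳ;
         m≤m+n; n≤0⇒n≡0; <⇒≢; module ≤-Reasoning)
open import Data.Nat.ListAction using (sum)
open import Data.Fin using (Fin; zero; suc) renaming (_≟_ to _≟ᶠ_)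
open import Data.Fin.Properties using (any?; suc-injective)
open import Data.Fin.Subset
  using (Subset; ∣_∣; ⊥; _∩_; _∪_; _⊆_; ⋃; inside; outside; Nonempty; Empty)
  renaming (_∈_ to _∈ₛ_; _∉_ to _∉ₛ_)
open import Data.Fin.Subset.Properties
  using (_∈?_; nonempty?; Empty-unique; ∣⊥∣≡0; ∉⊥; p⊆q⇒∣p∣≤∣q∣; x∈p∩q⁺; x∈p∩q⁻; x∈p∪q⁺; x∈p∪q⁻)
open import Data.Vec using ([]; _∷_; here; there)
open import Data.List using (tabulate)
open import Data.List.Properties using (tabulate-cong)
open import Data.Product using (∃; ∃!; _×_; _,_; proj₁; proj₂)
open import Data.Sum using (_⊎_; inj₁; inj₂)
open import Data.Unit using (⊤; tt)
open import Function using (_∘_)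
open import Relation.Nullary using (¬_; yes; no; does; contradiction; ¬?; _×-dec_)
open import Relation.Nullary.Decidable using (decidable-stable; ¬¬-excluded-middle)
open import Relation.Unary using (Decidable)
open import Relation.Binary.PropositionalEquality
  using (_≡_; refl; sym; trans; cong; subst; module ≡-Reasoning)

module _ {n : ℕ} {R : Fin n → Fin n → Set} {X : VSet n} where

  source∈ : ∀ {u v} → Path R X u v → X u
  source∈ (stop x)     = x
  source∈ (step x _ _) = x

  target∈ : ∀ {u v} → Path R X u v → X v
  target∈ (stop x)     = x
  target∈ (step _ _ p) = target∈ p

  infixr 5 _++ₚ_
  _++ₚ_ : ∀ {u v w} → Path R X u v → Path R X v w → Path R X u w
  stop _     ++ₚ q = q
  step x r p ++ₚ q = step x r (p ++ₚ q)

  reverseₚ : (∀ {a b} → R a b → R b a) → ∀ {u v} → Path R X u v → Path R X v u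
  reverseₚ R-sym (stop x)     = stop x
  reverseₚ R-sym (step x r p) = reverseₚ R-sym p ++ₚ step (source∈ p) (R-sym r) (stop x)

  within-reach : ∀ {a u v} → Path R X a u → Path R X u v → Path R (Path R X a) u v
  within-reach a⇝u (stop _)     = stop a⇝u
  within-reach a⇝u (step x r p) =
    step a⇝u r (within-reach (a⇝u ++ₚ step x r (stop (source∈ p))) p)

  Path-isComponent : (∀ {a b} → R a b → R b a) → ∀ {a} → X a → IsComponent R X (Path R X a)
  Path-isComponent R-sym {a} x =
    (λ _ → target∈) ,
    ((a , stop x) , λ _ _ a⇝u a⇝v → within-reach a⇝u (reverseₚ R-sym a⇝u ++ₚ a⇝v)) ,
    (λ _ _ → _++ₚ_)

mapₚ : ∀ {n} {R R′ : Fin n → Fin n → Set} {X Y : VSet n} →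
       (∀ {v} → X v → Y v) → (∀ {u v} → X u → X v → R u v → R′ u v) →
       ∀ {u v} → Path R X u v → Path R′ Y u v
mapₚ f g (stop x)     = stop (f x)
mapₚ f g (step x r p) = step (f x) (g x (source∈ p) r) (mapₚ f g p)

∣p∪q∣+∣p∩q∣≡∣p∣+∣q∣ : ∀ {n} (p q : Subset n) → ∣ p ∪ q ∣ + ∣ p ∩ q ∣ ≡ ∣ p ∣ + ∣ q ∣
∣p∪q∣+∣p∩q∣≡∣p∣+∣q∣ []            []            = refl
∣p∪q∣+∣p∩q∣≡∣p∣+∣q∣ (inside  ∷ p) (inside  ∷ q) = cong suc (begin
  ∣ p ∪ q ∣ + suc ∣ p ∩ q ∣ ≡⟨ +-suc ∣ p ∪ q ∣ ∣ p ∩ q ∣ ⟩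
  suc (∣ p ∪ q ∣ + ∣ p ∩ q ∣) ≡⟨ cong suc (∣p∪q∣+∣p∩q∣≡∣p∣+∣q∣ p q) ⟩
  suc (∣ p ∣ + ∣ q ∣)         ≡⟨ sym (+-suc ∣ p ∣ ∣ q ∣) ⟩
  ∣ p ∣ + suc ∣ q ∣           ∎)
  where open ≡-Reasoning
∣p∪q∣+∣p∩q∣≡∣p∣+∣q∣ (inside  ∷ p) (outside ∷ q) = cong suc (∣p∪q∣+∣p∩q∣≡∣p∣+∣q∣ p q)
∣p∪q∣+∣p∩q∣≡∣p∣+∣q∣ (outside ∷ p) (inside  ∷ q) =
  trans (cong suc (∣p∪q∣+∣p∩q∣≡∣p∣+∣q∣ p q)) (sym (+-suc ∣ p ∣ ∣ q ∣))
∣p∪q∣+∣p∩q∣≡∣p∣+∣q∣ (outside ∷ p) (outside ∷ q) = ∣p∪q∣+∣p∩q∣≡∣p∣+∣q∣ p q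

Empty⇒∣p∣≡0 : ∀ {n} {p : Subset n} → Empty p → ∣ p ∣ ≡ 0
Empty⇒∣p∣≡0 {n} p-empty = trans (cong ∣_∣ (Empty-unique p-empty)) (∣⊥∣≡0 n)

∣p∪q∣≤∣p∣+∣q∣ : ∀ {n} (p q : Subset n) → ∣ p ∪ q ∣ ≤ ∣ p ∣ + ∣ q ∣
∣p∪q∣≤∣p∣+∣q∣ p q =
  ≤-trans (m≤m+n ∣ p ∪ q ∣ ∣ p ∩ q ∣) (≤-reflexive (∣p∪q∣+∣p∩q∣≡∣p∣+∣q∣ p q))

Empty[p∩q]⇒∣p∪q∣≡∣p∣+∣q∣ : ∀ {n} (p q : Subset n) → Empty (p ∩ q) → ∣ p ∪ q ∣ ≡ ∣ p ∣ + ∣ q ∣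
Empty[p∩q]⇒∣p∪q∣≡∣p∣+∣q∣ p q p∩q-empty = begin
  ∣ p ∪ q ∣             ≡⟨ sym (+-identityʳ ∣ p ∪ q ∣) ⟩
  ∣ p ∪ q ∣ + 0         ≡⟨ cong (∣ p ∪ q ∣ +_) (Empty⇒∣p∣≡0 p∩q-empty) ⟨
  ∣ p ∪ q ∣ + ∣ p ∩ q ∣ ≡⟨ ∣p∪q∣+∣p∩q∣≡∣p∣+∣q∣ p q ⟩
  ∣ p ∣ + ∣ q ∣         ∎
  where open ≡-Reasoning

0<∣p∣⇒Nonempty : ∀ {n} {p : Subset n} → 0 < ∣ p ∣ → Nonempty p
0<∣p∣⇒Nonempty {p = p} 0<∣p∣ with nonempty? p
... | yes p-nonempty = p-nonempty
... | no  p-empty    =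
  contradiction (Empty⇒∣p∣≡0 p-empty) (<⇒≢ 0<∣p∣ ∘ sym)

fromDec : ∀ {n} {P : Fin n → Set} → Decidable P → Subset n
fromDec {zero}  P? = []
fromDec {suc n} P? = does (P? zero) ∷ fromDec (P? ∘ suc)

∈-fromDec⁺ : ∀ {n} {P : Fin n → Set} (P? : Decidable P) {x} → P x → x ∈ₛ fromDec P?
∈-fromDec⁺ P? {zero} px with P? zero
... | yes _  = here
... | no ¬px = contradiction px ¬px
∈-fromDec⁺ P? {suc x} px = there (∈-fromDec⁺ (P? ∘ suc) px)

∈-fromDec⁻ : ∀ {n} {P : Fin n → Set} (P? : Decidable P) {x} → x ∈ₛ fromDec P? → P x
∈-fromDec⁻ P? {zero} x∈ with P? zero | x∈
... | yes px | _  = px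
... | no _   | ()
∈-fromDec⁻ P? {suc x} (there x∈) = ∈-fromDec⁻ (P? ∘ suc) x∈

module _ {n : ℕ} where

  ∈⋃⁺ : ∀ {m} (S : Fin m → Subset n) i {x} → x ∈ₛ S i → x ∈ₛ ⋃ (tabulate S)
  ∈⋃⁺ S zero    x∈ = x∈p∪q⁺ (inj₁ x∈)
  ∈⋃⁺ S (suc i) x∈ = x∈p∪q⁺ (inj₂ (∈⋃⁺ (S ∘ suc) i x∈))

  ∈⋃⁻ : ∀ {m} (S : Fin m → Subset n) {x} → x ∈ₛ ⋃ (tabulate S) → ∃ λ i → x ∈ₛ S i
  ∈⋃⁻ {zero}  S x∈ = contradiction x∈ ∉⊥
  ∈⋃⁻ {suc m} S x∈ with x∈p∪q⁻ (S zero) (⋃ (tabulate (S ∘ suc))) x∈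
  ... | inj₁ x∈S₀ = zero , x∈S₀
  ... | inj₂ x∈⋃ with ∈⋃⁻ (S ∘ suc) x∈⋃
  ...   | i , x∈Sᵢ = suc i , x∈Sᵢ

  ∣⋃∣≤sumFin : ∀ {m} (S : Fin m → Subset n) → ∣ ⋃ (tabulate S) ∣ ≤ sumFin (∣_∣ ∘ S)
  ∣⋃∣≤sumFin {zero}  S = ≤-reflexive (∣⊥∣≡0 n)
  ∣⋃∣≤sumFin {suc m} S =
    ≤-trans (∣p∪q∣≤∣p∣+∣q∣ (S zero) _) (+-mono-≤ ≤-refl (∣⋃∣≤sumFin (S ∘ suc)))

  disjoint⇒∣⋃∣≡sumFin : ∀ {m} (S : Fin m → Subset n) →
                        (∀ i j x → x ∈ₛ S i → x ∈ₛ S j → i ≡ j) →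
                        ∣ ⋃ (tabulate S) ∣ ≡ sumFin (∣_∣ ∘ S)
  disjoint⇒∣⋃∣≡sumFin {zero}  S _        = ∣⊥∣≡0 n
  disjoint⇒∣⋃∣≡sumFin {suc m} S disjoint = trans
    (Empty[p∩q]⇒∣p∪q∣≡∣p∣+∣q∣ (S zero) _ S₀∩⋃-empty)
    (cong (∣ S zero ∣ +_) (disjoint⇒∣⋃∣≡sumFin (S ∘ suc) disjoint-suc))
    where
    disjoint-suc : ∀ i j x → x ∈ₛ S (suc i) → x ∈ₛ S (suc j) → i ≡ j
    disjoint-suc i j x x∈Sᵢ x∈Sⱼ = suc-injective (disjoint (suc i) (suc j) x x∈Sᵢ x∈Sⱼ)
    S₀∩⋃-empty : Empty (S zero ∩ ⋃ (tabulate (S ∘ suc)))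
    S₀∩⋃-empty (x , x∈∩) with x∈p∩q⁻ (S zero) _ x∈∩
    ... | x∈S₀ , x∈⋃ with ∈⋃⁻ (S ∘ suc) x∈⋃
    ...   | i , x∈Sᵢ with disjoint zero (suc i) x x∈S₀ x∈Sᵢ
    ...     | ()

sumFin-mono : ∀ {m} {f g : Fin m → ℕ} → (∀ i → f i ≤ g i) → sumFin f ≤ sumFin g
sumFin-mono {zero}  f≤g = z≤n
sumFin-mono {suc m} f≤g = +-mono-≤ (f≤g zero) (sumFin-mono (f≤g ∘ suc))

¬¬-∀-Fin : ∀ {m} {A : Fin m → Set} → (∀ i → ¬ ¬ A i) → ¬ ¬ (∀ i → A i)
¬¬-∀-Fin {zero}  _   ¬∀A = ¬∀A λ ()
¬¬-∀-Fin {suc m} ¬¬A ¬∀A = ¬¬A zero λ A₀ → ¬¬-∀-Fin (¬¬A ∘ suc) λ A₊ →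
  ¬∀A λ { zero → A₀ ; (suc i) → A₊ i }

module _ {n : ℕ} (G : Graph n) (t : ℕ) where

  Kt-free⇒opt≡0 : ∀ {X k} → (∀ K → ¬ IsCliqueIn G t X K) → Opt G t X k → k ≡ 0
  Kt-free⇒opt≡0 {X} Kt-free (_ , minimal) =
    n≤0⇒n≡0 (≤-trans (minimal ⊥ ∅-transversal) (≤-reflexive (∣⊥∣≡0 n)))
    where
    ∅-transversal : IsTransversal G t X ⊥
    ∅-transversal = (λ _ v∈⊥ → contradiction v∈⊥ ∉⊥) ,
                    λ K K-clique → contradiction K-clique (Kt-free K)

  ⋃-transversal : ∀ {m} {X : Fin m → VSet n} {S : Fin m → Subset n} →
                  (∀ K → IsClique G t K → ∃ λ i → ∀ v → v ∈ₛ K → X i v) →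
                  (∀ i → IsTransversal G t (X i) (S i)) →
                  IsTransversal G t (λ _ → ⊤) (⋃ (tabulate S))
  ⋃-transversal {S = S} cliques-inside S-transversal = (λ _ _ → tt) , hit
    where
    hit : ∀ K → IsCliqueIn G t (λ _ → ⊤) K → ∃ λ v → v ∈ₛ ⋃ (tabulate S) × v ∈ₛ K
    hit K (_ , K-clique) with cliques-inside K K-clique
    ... | i , K⊆Xᵢ with proj₂ (S-transversal i) K (K⊆Xᵢ , K-clique)
    ...   | v , v∈Sᵢ , v∈K = v , ∈⋃⁺ S i v∈Sᵢ , v∈K

  ∩-transversal : ∀ {X : VSet n} {S} (X? : Decidable X) →
                  IsTransversal G t (λ _ → ⊤) S → IsTransversal G t X (S ∩ fromDec X?)
  ∩-transversal {X} {S} X? (_ , S-hits) =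
    (λ v v∈ → ∈-fromDec⁻ X? (proj₂ (x∈p∩q⁻ S _ v∈))) , hit
    where
    hit : ∀ K → IsCliqueIn G t X K → ∃ λ v → v ∈ₛ S ∩ fromDec X? × v ∈ₛ K
    hit K (K⊆X , K-clique) with S-hits K ((λ _ _ → tt) , K-clique)
    ... | v , v∈S , v∈K = v , x∈p∩q⁺ (v∈S , ∈-fromDec⁺ X? (K⊆X v v∈K)) , v∈K

  module _ {m} {X : Fin m → VSet n} {k : ℕ} {kX : Fin m → ℕ}
           (opt : Opt G t (λ _ → ⊤) k) (optX : ∀ i → Opt G t (X i) (kX i)) where

    opt≤sum : (∀ K → IsClique G t K → ∃ λ i → ∀ v → v ∈ₛ K → X i v) → k ≤ sumFin kX
    opt≤sum cliques-inside = begin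
      k                       ≤⟨ proj₂ opt _ (⋃-transversal cliques-inside S-transversal) ⟩
      ∣ ⋃ (tabulate S) ∣      ≤⟨ ∣⋃∣≤sumFin S ⟩
      sumFin (∣_∣ ∘ S)        ≡⟨ cong sum (tabulate-cong (proj₂ ∘ proj₂ ∘ proj₁ ∘ optX)) ⟩
      sumFin kX               ∎
      where
      open ≤-Reasoning
      S : Fin m → Subset n
      S i = proj₁ (proj₁ (optX i))
      S-transversal : ∀ i → IsTransversal G t (X i) (S i)
      S-transversal i = proj₁ (proj₂ (proj₁ (optX i)))

    -- Membership in X i need not be decidable, but the goal is, so we may assume it is.
    sum≤opt : (∀ i j v → X i v → X j v → i ≡ j) → sumFin kX ≤ k
    sum≤opt disjoint = decidable-stable (sumFin kX ≤? k) λ sum≰opt →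
      ¬¬-∀-Fin (λ i → ¬¬-∀-Fin λ v → ¬¬-excluded-middle) (sum≰opt ∘ sum≤opt-dec)
      where
      S : Subset n
      S = proj₁ (proj₁ opt)
      sum≤opt-dec : (∀ i → Decidable (X i)) → sumFin kX ≤ k
      sum≤opt-dec X? = begin
        sumFin kX            ≤⟨ sumFin-mono (λ i → proj₂ (optX i) (Sᵢ i) (Sᵢ-transversal i)) ⟩
        sumFin (∣_∣ ∘ Sᵢ)    ≡⟨ disjoint⇒∣⋃∣≡sumFin Sᵢ Sᵢ-disjoint ⟨
        ∣ ⋃ (tabulate Sᵢ) ∣  ≤⟨ p⊆q⇒∣p∣≤∣q∣ ⋃Sᵢ⊆S ⟩
        ∣ S ∣                ≡⟨ proj₂ (proj₂ (proj₁ opt)) ⟩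
        k                    ∎
        where
        open ≤-Reasoning
        Sᵢ : Fin m → Subset n
        Sᵢ i = S ∩ fromDec (X? i)
        Sᵢ-transversal : ∀ i → IsTransversal G t (X i) (Sᵢ i)
        Sᵢ-transversal i = ∩-transversal (X? i) (proj₁ (proj₂ (proj₁ opt)))
        Sᵢ⊆Xᵢ : ∀ i {v} → v ∈ₛ Sᵢ i → X i v
        Sᵢ⊆Xᵢ i v∈ = ∈-fromDec⁻ (X? i) (proj₂ (x∈p∩q⁻ S _ v∈))
        Sᵢ-disjoint : ∀ i j v → v ∈ₛ Sᵢ i → v ∈ₛ Sᵢ j → i ≡ j
        Sᵢ-disjoint i j v v∈Sᵢ v∈Sⱼ = disjoint i j v (Sᵢ⊆Xᵢ i v∈Sᵢ) (Sᵢ⊆Xᵢ j v∈Sⱼ)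
        ⋃Sᵢ⊆S : ⋃ (tabulate Sᵢ) ⊆ S
        ⋃Sᵢ⊆S v∈⋃ with ∈⋃⁻ Sᵢ v∈⋃
        ... | i , v∈Sᵢ = proj₁ (x∈p∩q⁻ S _ v∈Sᵢ)

  opt-additive : ∀ {m} {X : Fin m → VSet n} {k : ℕ} {kX : Fin m → ℕ} →
                 (∀ i j v → X i v → X j v → i ≡ j) →
                 (∀ K → IsClique G t K → ∃ λ i → ∀ v → v ∈ₛ K → X i v) →
                 Opt G t (λ _ → ⊤) k → (∀ i → Opt G t (X i) (kX i)) → k ≡ sumFin kX
  opt-additive disjoint cliques-inside opt optX =
    ≤-antisym (opt≤sum opt optX cliques-inside) (sum≤opt opt optX disjoint)

module _ {n : ℕ} (G : Graph n) {t : ℕ} where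

  clique-nonempty : ∀ {K} → 0 < t → IsClique G t K → Nonempty K
  clique-nonempty 0<t (∣K∣≡t , _) = 0<∣p∣⇒Nonempty (subst (0 <_) (sym ∣K∣≡t) 0<t)

  NonKtVertices⇒Kt-free : ∀ {N} → 0 < t → NonKtVertices G t N →
                          ∀ K → ¬ IsCliqueIn G t (_∈ₛ N) K
  NonKtVertices⇒Kt-free 0<t nonKt K (K⊆N , K-clique) with clique-nonempty 0<t K-clique
  ... | v , v∈K = nonKt K K-clique v v∈K (K⊆N v v∈K)

  clique-Path : ∀ {X : VSet n} {K a v} → IsClique G t K → a ∈ₛ K → v ∈ₛ K → X a → X v →
                Path (E G) X a v
  clique-Path {a = a} {v} (_ , adjacent) a∈K v∈K Xa Xv with v ≟ᶠ a
  ... | yes refl = stop Xa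
  ... | no  v≢a  = step Xa (adjacent a v a∈K v∈K (v≢a ∘ sym)) (stop Xv)

module PendingComponents {n : ℕ} {G : Graph n} {t : ℕ} {N T : Subset n}
                         (root : IsRoot G t N T) where

  Component : Fin n → VSet n
  Component a = Path (E G) (Minus N) a

  Outside : VSet n
  Outside v = v ∉ₛ N × v ∉ₛ T

  Dangling : Fin n → VSet n
  Dangling a = Path (E G) Outside a

  Attached : Fin n → Fin n → Set
  Attached a r = r ∈ₛ T × ∃ λ d → Dangling a d × E G d r

  -- OwnedBy a r holds iff a ∈ C(r): then r is a itself if a ∈ V(𝒯), and otherwise the
  -- vertex of V(𝒯) at which the component of a in G − N − V(𝒯) is attached.
  OwnedBy : Fin n → Fin n → Set
  OwnedBy a r = (a ∈ₛ T × a ≡ r) ⊎ (a ∉ₛ T × Attached a r)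

  Dangling⊆Component : ∀ {a d} → Dangling a d → Component a d
  Dangling⊆Component = mapₚ proj₁ (λ _ _ e → e)

  Attached⇒Component : ∀ {a r} → Attached a r → Component a r
  Attached⇒Component (r∈T , d , a⇝d , d~r) =
    Dangling⊆Component a⇝d ++ₚ step (proj₁ (target∈ a⇝d)) d~r (stop (proj₁ root _ r∈T))

  rootOfComponent : ∀ {a} → a ∉ₛ N →
                    IsRootOfConnected G t (Component a) (λ v → Component a v × v ∈ₛ T)
  rootOfComponent {a} a∉N = proj₂ root (Component a) (Path-isComponent (E-sym G) a∉N)

  Dangling-isComponent : ∀ {a} → a ∉ₛ N → a ∉ₛ T →
    IsComponent (E G) (λ v → Component a v × ¬ (Component a v × v ∈ₛ T)) (Dangling a)
  Dangling-isComponent a∉N a∉T =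
    (λ _ a⇝d → Dangling⊆Component a⇝d , proj₂ (target∈ a⇝d) ∘ proj₂) ,
    proj₁ (proj₂ (Path-isComponent (E-sym G) (a∉N , a∉T))) ,
    λ _ _ a⇝u u⇝v → a⇝u ++ₚ mapₚ toOutside (λ _ _ e → e) u⇝v
    where
    toOutside : ∀ {a v} → Component a v × ¬ (Component a v × v ∈ₛ T) → Outside v
    toOutside (a⇝v , ¬a⇝v∈T) = target∈ a⇝v , λ v∈T → ¬a⇝v∈T (a⇝v , v∈T)

  attachment : ∀ {a} → a ∉ₛ N → a ∉ₛ T → ∃! _≡_ (Attached a)
  attachment {a} a∉N a∉T
    with proj₂ (proj₂ (proj₂ (rootOfComponent a∉N))) (Dangling a) (Dangling-isComponent a∉N a∉T)
  ... | r , ((_ , r∈T) , a~r) , unique = r , (r∈T , a~r) ,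
    λ a~w@(w∈T , a~w′) → sym (unique _ (Attached⇒Component a~w , w∈T) a~w′)

  attached-unique : ∀ {a r r′} → a ∉ₛ N → a ∉ₛ T → Attached a r → Attached a r′ → r ≡ r′
  attached-unique a∉N a∉T a~r a~r′ with attachment a∉N a∉T
  ... | _ , _ , unique = trans (sym (unique a~r)) (unique a~r′)

  OwnedBy-unique : ∀ {x r r′} → x ∉ₛ N → OwnedBy x r → OwnedBy x r′ → r ≡ r′
  OwnedBy-unique _   (inj₁ (_ , refl))  (inj₁ (_ , refl))   = refl
  OwnedBy-unique _   (inj₁ (x∈T , _))   (inj₂ (x∉T , _))    = contradiction x∈T x∉T
  OwnedBy-unique _   (inj₂ (x∉T , _))   (inj₁ (x∈T , _))    = contradiction x∈T x∉T
  OwnedBy-unique x∉N (inj₂ (x∉T , x~r)) (inj₂ (_ , x~r′))   = attached-unique x∉N x∉T x~r x~r′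

  OwnedBy-step : ∀ {u w r} → u ∉ₛ N → w ∉ₛ N → PendingEdge G N T u w → OwnedBy u r → OwnedBy w r
  OwnedBy-step {w = w} u∉N w∉N (u~w , not-both) (inj₁ (u∈T , refl)) =
    inj₂ (w∉T , u∈T , _ , stop (w∉N , w∉T) , E-sym G u~w)
    where
    w∉T : w ∉ₛ T
    w∉T = λ w∈T → not-both (u∈T , w∈T)
  OwnedBy-step {u} {w} u∉N w∉N (u~w , _) (inj₂ (u∉T , u~r@(r∈T , d , u⇝d , d~r))) with w ∈? T
  ... | yes w∈T = inj₁ (w∈T , attached-unique u∉N u∉T (w∈T , u , stop (u∉N , u∉T) , u~w) u~r)
  ... | no  w∉T = inj₂ (w∉T , r∈T , d , step (w∉N , w∉T) (E-sym G u~w) u⇝d , d~r)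

  Pending⇒OwnedBy : ∀ {r x} → r ∈ₛ T → Pending G N T r x → OwnedBy x r
  Pending⇒OwnedBy r∈T = go (inj₁ (r∈T , refl))
    where
    go : ∀ {u x r} → OwnedBy u r → Path (PendingEdge G N T) (Minus N) u x → OwnedBy x r
    go owned (stop _)           = owned
    go owned (step u∉N u~w w⇝x) = go (OwnedBy-step u∉N (source∈ w⇝x) u~w owned) w⇝x

  Pending-disjoint : ∀ {r r′ x} → r ∈ₛ T → r′ ∈ₛ T →
                     Pending G N T r x → Pending G N T r′ x → r ≡ r′
  Pending-disjoint r∈T r′∈T r⇝x r′⇝x =
    OwnedBy-unique (target∈ r⇝x) (Pending⇒OwnedBy r∈T r⇝x) (Pending⇒OwnedBy r′∈T r′⇝x)

  Outside-Path⇒Pending : ∀ {u v} → Path (E G) Outside u v → Pending G N T u v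
  Outside-Path⇒Pending = mapₚ proj₁ λ (_ , u∉T) _ u~v → u~v , u∉T ∘ proj₁

  module _ (0<t : 0 < t) (nonKt : NonKtVertices G t N)
           {K : Subset n} (K-clique : IsClique G t K) where

    private
      K⊆Minus : ∀ v → v ∈ₛ K → v ∉ₛ N
      K⊆Minus = nonKt K K-clique

    clique-⊈-root : ∃ λ a → a ∈ₛ K × a ∉ₛ T
    clique-⊈-root with any? (λ v → (v ∈? K) ×-dec ¬? (v ∈? T))
    ... | yes K∖T-nonempty = K∖T-nonempty
    ... | no  K∖T-empty    with clique-nonempty G 0<t K-clique
    ...   | x , x∈K = contradiction (K⊆Tₓ , K-clique) (Kt-free K)
      where
      Kt-free : ∀ K′ → ¬ IsCliqueIn G t (λ v → Component x v × v ∈ₛ T) K′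
      Kt-free = proj₁ (proj₂ (proj₂ (rootOfComponent (K⊆Minus x x∈K))))
      K⊆Tₓ : ∀ v → v ∈ₛ K → Component x v × v ∈ₛ T
      K⊆Tₓ v v∈K = clique-Path G K-clique x∈K v∈K (K⊆Minus x x∈K) (K⊆Minus v v∈K) ,
                   decidable-stable (v ∈? T) (λ v∉T → K∖T-empty (v , v∈K , v∉T))

    clique-⊆-Pending : ∃ λ r → r ∈ₛ T × ∀ x → x ∈ₛ K → Pending G N T r x
    clique-⊆-Pending with clique-⊈-root
    ... | a , a∈K , a∉T with attachment (K⊆Minus a a∈K) a∉T
    ...   | r , (r∈T , d , a⇝d , d~r) , unique = r , r∈T , K⊆Pendingᵣ
      where
      a-Outside : Outside a
      a-Outside = K⊆Minus a a∈K , a∉T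
      r∉N : r ∉ₛ N
      r∉N = proj₁ root r r∈T
      K⊆Pendingᵣ : ∀ x → x ∈ₛ K → Pending G N T r x
      K⊆Pendingᵣ x x∈K with x ∈? T
      ... | yes x∈T = subst (Pending G N T r) (unique (x∈T , a , stop a-Outside , a~x)) (stop r∉N)
        where
        a~x : E G a x
        a~x = proj₂ K-clique a x a∈K x∈K λ { refl → a∉T x∈T }
      ... | no  x∉T = step r∉N (E-sym G d~r , proj₂ (target∈ a⇝d) ∘ proj₂)
        (Outside-Path⇒Pending (reverseₚ (E-sym G) a⇝d ++ₚ
                               clique-Path G K-clique a∈K x∈K a-Outside (K⊆Minus x x∈K , x∉T)))

  module _ {m} {P : Fin m → Subset n} (partition : IsPartitionOf P T) where

    private
      P⊆T : ∀ i v → v ∈ₛ P i → v ∈ₛ T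
      P⊆T = proj₂ (proj₂ (proj₂ partition))

    PendingSet-disjoint : ∀ i j x → PendingSet G N T (P i) x → PendingSet G N T (P j) x → i ≡ j
    PendingSet-disjoint i j x (v , v∈Pᵢ , v⇝x) (v′ , v′∈Pⱼ , v′⇝x) =
      proj₁ (proj₂ partition) i j v v∈Pᵢ
        (subst (_∈ₛ P j) (Pending-disjoint (P⊆T j v′ v′∈Pⱼ) (P⊆T i v v∈Pᵢ) v′⇝x v⇝x) v′∈Pⱼ)

    clique-⊆-PendingSet : 0 < t → NonKtVertices G t N → ∀ K → IsClique G t K →
                          ∃ λ i → ∀ x → x ∈ₛ K → PendingSet G N T (P i) x
    clique-⊆-PendingSet 0<t nonKt K K-clique with clique-⊆-Pending 0<t nonKt K-clique
    ... | r , r∈T , K⊆Pendingᵣ with proj₁ (proj₂ (proj₂ partition)) r r∈T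
    ...   | i , r∈Pᵢ = i , λ x x∈K → r , r∈Pᵢ , K⊆Pendingᵣ x x∈K

lemma16 : ∀ {n} (t : ℕ) → 3 ≤ t → (G : Graph n) (N T : Subset n) →
          NonKtVertices G t N → IsRoot G t N T →
          ∀ {m} (P : Fin m → Subset n) → IsPartitionOf P T →
          ∀ (k kN : ℕ) (kZ : Fin m → ℕ) →
          Opt G t (λ _ → ⊤) k →
          Opt G t (λ v → v ∈ₛ N) kN →
          (∀ i → Opt G t (PendingSet G N T (P i)) (kZ i)) →
          k ≡ kN + sumFin kZ
lemma16 t 3≤t G N T nonKt root P partition k kN kZ opt optN optZ = begin
  k              ≡⟨ opt-additive G t (PendingSet-disjoint partition)
                                     (clique-⊆-PendingSet partition 0<t nonKt) opt optZ ⟩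
  sumFin kZ      ≡⟨ cong (_+ sumFin kZ) kN≡0 ⟨
  kN + sumFin kZ ∎
  where
  open ≡-Reasoning
  open PendingComponents {G = G} root
  0<t : 0 < t
  0<t = ≤-trans (s≤s z≤n) 3≤t
  kN≡0 : kN ≡ 0
  kN≡0 = Kt-free⇒opt≡0 G t (NonKtVertices⇒Kt-free G 0<t nonKt) optN
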